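{- In the multirole logic MRL over a set of roles $\mathcal{R}$, for every sequent $\Gamma$ and every formula $A$, the sequent $\vdash\Gamma,[\mathcal{R}]A$ is derivable.
   Context: Fix a set $\mathcal{R}$ (the set of roles), possibly infinite. For $R\subseteq\mathcal{R}$ write $\overline{R}=\mathcal{R}\setminus R$. Writing $R_1\uplus\cdots\uplus R_n$ means the union of the pairwise disjoint sets $R_1,\dots,R_n$ (the notation asserts disjointness). A filter on $\mathcal{R}$ is a set $\mathcal{F}$ of subsets of $\mathcal{R}$ with $\mathcal{R}\in\mathcal{F}$, such that $R_1\in\mathcal{F}$ and $R_1\subseteq R_2$ imply $R_2\in\mathcal{F}$, and $R_1,R_2\in\mathcal{F}$ imply $R_1\cap R_2\in\mathcal{F}$; an ultrafilter $\mathcal{U}$ is a filter such that for every $R\subseteq\mathcal{R}$, $R\in\mathcal{U}$ or $\overline{R}\in\mathcal{U}$. An endomorphism is any function $f:\mathcal{R}\to\mathcal{R}$, and $f^{ -1}(R)$ is the preimage. First-order terms $t$ and atomic formulas $a$ are standard. Formulas of MRL: $A ::= a \mid \neg_f(A) \mid A_1\wedge_{\mathcal{U}}A_2 \mid A\supset_{f,\mathcal{U}}B \mid \forall_{\mathcal{U}}(\lambda x.A)$, with $f$ an endomorphism and $\mathcal{U}$ an ultrafilter on $\mathcal{R}$; $A[x:=t]$ is substitution. An i-formula is $[R]A$ with $R\subseteq\mathcal{R}$ and $A$ a formula. A sequent $\Gamma$ is a finite multiset of i-formulas; commas denote multiset union. Derivable sequents $\vdash\Gamma$ are generated by the rules: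 (Id) $\vdash\Gamma,[R_1]a,\dots,[R_n]a$ for any $\Gamma$, atomic $a$, $n\ge1$ and $R_1\uplus\cdots\uplus R_n=\mathcal{R}$; (contraction) from $\vdash\Gamma,[R]A,[R]A$ infer $\vdash\Gamma,[R]A$; ($\neg$) from $\vdash\Gamma,[f^{ -1}(R)]A$ infer $\vdash\Gamma,[R]\neg_f(A)$; ($\wedge$-neg) if $R\notin\mathcal{U}$, from $\vdash\Gamma,[R]A$ or from $\vdash\Gamma,[R]B$ infer $\vdash\Gamma,[R](A\wedge_{\mathcal{U}}B)$; ($\wedge$-pos) if $R\in\mathcal{U}$, from $\vdash\Gamma,[R]A$ and $\vdash\Gamma,[R]B$ infer $\vdash\Gamma,[R](A\wedge_{\mathcal{U}}B)$; ($\supset$-neg) if $R\notin\mathcal{U}$, from $\vdash\Gamma,[f^{ -1}(R)]A,[R]B$ infer $\vdash\Gamma,[R](A\supset_{f,\mathcal{U}}B)$; ($\supset$-pos) if $R\in\mathcal{U}$, from $\vdash\Gamma_1,[f^{ -1}(R)]A$ and $\vdash\Gamma_2,[R]B$ infer $\vdash\Gamma_1,\Gamma_2,[R](A\supset_{f,\mathcal{U}}B)$; ($\forall$-neg) if $R\notin\mathcal{U}$, from $\vdash\Gamma,[R]A[x:=t]$ for some term $t$ infer $\vdash\Gamma,[R]\forall_{\mathcal{U}}(\lambda x.A)$; ($\forall$-pos) if $R\in\mathcal{U}$ and $x$ has no free occurrence in $\Gamma$, from $\vdash\Gamma,[R]A$ infer $\vdash\Gamma,[R]\forall_{\mathcal{U}}(\lambda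 x.A)$. -}

module Defs where

open import Data.Nat using (ℕ; zero; suc; _<ᵇ_; _≡ᵇ_; _∸_)
open import Data.Bool using (Bool; true; false; if_then_else_)
open import Data.Fin using (Fin)
open import Data.List using (List; []; _∷_; _++_; map; tabulate)
open import Data.Product using (_×_; _,_; Σ; ∃)
open import Data.Sum using (_⊎_)
open import Data.Unit using (⊤)
open import Data.Empty using (⊥)
open import Relation.Nullary using (¬_)
open import Relation.Binary.PropositionalEquality using (_≡_)
open import Data.List.Relation.Binary.Permutation.Propositional using (_↭_)

module MRL (Role : Set) (Fun : Set) (PSym : Set) where

  -- First-order terms; variables are de Bruijn indices.
  data Term : Set where
    var : ℕ → Term
    fn  : Fun → List Term → Term

  Subset : Set₁
  Subset = Role → Set

  full : Subset
  full _ = ⊤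

  compl : Subset → Subset
  compl R r = ¬ R r

  _⊆_ : Subset → Subset → Set
  R₁ ⊆ R₂ = ∀ r → R₁ r → R₂ r

  _∩_ : Subset → Subset → Subset
  (R₁ ∩ R₂) r = R₁ r × R₂ r

  preimage : (Role → Role) → Subset → Subset
  preimage f R r = R (f r)

  record IsFilter (F : Subset → Set) : Set₁ where
    field
      full∈ : F full
      up    : ∀ {R₁ R₂} → F R₁ → R₁ ⊆ R₂ → F R₂
      meet  : ∀ {R₁ R₂} → F R₁ → F R₂ → F (R₁ ∩ R₂)

  record Ultrafilter : Set₁ where
    field
      member   : Subset → Set
      isFilter : IsFilter member
      ultra    : ∀ R → member R ⊎ member (compl R)
  open Ultrafilter public

  -- Formulas. In  all U A  the body A binds de Bruijn index 0  (∀_U(λx.A)).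
  data Formula : Set₁ where
    atom : PSym → List Term → Formula
    neg  : (Role → Role) → Formula → Formula
    and  : Ultrafilter → Formula → Formula → Formula
    imp  : (Role → Role) → Ultrafilter → Formula → Formula → Formula
    all  : Ultrafilter → Formula → Formula

  mutual
    wkT : ℕ → Term → Term
    wkT c (var n) = if n <ᵇ c then var n else var (suc n)
    wkT c (fn g ts) = fn g (wkTs c ts)

    wkTs : ℕ → List Term → List Term
    wkTs c [] = []
    wkTs c (t ∷ ts) = wkT c t ∷ wkTs c ts

  liftN : ℕ → Term → Term
  liftN zero t = t
  liftN (suc d) t = wkT 0 (liftN d t)

  mutual
    sbT : ℕ → Term → Term → Term
    sbT d t (var n) =
      if n <ᵇ d then var n else (if n ≡ᵇ d then liftN d t else var (n ∸ 1))
    sbT d t (fn g ts) = fn g (sbTs d t ts)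

    sbTs : ℕ → Term → List Term → List Term
    sbTs d t [] = []
    sbTs d t (u ∷ us) = sbT d t u ∷ sbTs d t us

  wkF : ℕ → Formula → Formula
  wkF c (atom P ts) = atom P (wkTs c ts)
  wkF c (neg f A) = neg f (wkF c A)
  wkF c (and U A B) = and U (wkF c A) (wkF c B)
  wkF c (imp f U A B) = imp f U (wkF c A) (wkF c B)
  wkF c (all U A) = all U (wkF (suc c) A)

  sbF : ℕ → Term → Formula → Formula
  sbF d t (atom P ts) = atom P (sbTs d t ts)
  sbF d t (neg f A) = neg f (sbF d t A)
  sbF d t (and U A B) = and U (sbF d t A) (sbF d t B)
  sbF d t (imp f U A B) = imp f U (sbF d t A) (sbF d t B)
  sbF d t (all U A) = all U (sbF (suc d) t A)

  _[0:=_] : Formula → Term → Formula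
  A [0:= t ] = sbF 0 t A

  -- i-formulas [R]A and sequents (multisets, represented as lists
  -- taken up to permutation via the rule `perm`)
  IFormula : Set₁
  IFormula = Subset × Formula

  Sequent : Set₁
  Sequent = List IFormula

  _,,_ : Sequent → IFormula → Sequent
  Γ ,, x = Γ ++ x ∷ []
  infixl 5 _,,_

  wkI : IFormula → IFormula
  wkI (R , A) = (R , wkF 0 A)

  PairwiseDisjoint : ∀ {n} → (Fin n → Subset) → Set
  PairwiseDisjoint Rs = ∀ i j → ¬ (i ≡ j) → ∀ r → Rs i r → Rs j r → ⊥

  CoversAll : ∀ {n} → (Fin n → Subset) → Set
  CoversAll Rs = ∀ r → ∃ λ i → Rs i r

  infix 3 ⊢_
  data ⊢_ : Sequent → Set₁ where
    perm : ∀ {Γ Δ} → Γ ↭ Δ → ⊢ Γ → ⊢ Δ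
    Id : ∀ Γ P ts n (Rs : Fin (suc n) → Subset) →
         PairwiseDisjoint Rs → CoversAll Rs →
         ⊢ Γ ++ tabulate (λ i → (Rs i , atom P ts))
    contraction : ∀ {Γ R A} → ⊢ Γ ,, (R , A) ,, (R , A) → ⊢ Γ ,, (R , A)
    ¬-rule : ∀ {Γ R f A} → ⊢ Γ ,, (preimage f R , A) → ⊢ Γ ,, (R , neg f A)
    ∧-neg₁ : ∀ {Γ R U A B} → ¬ member U R →
             ⊢ Γ ,, (R , A) → ⊢ Γ ,, (R , and U A B)
    ∧-neg₂ : ∀ {Γ R U A B} → ¬ member U R →
             ⊢ Γ ,, (R , B) → ⊢ Γ ,, (R , and U A B)
    ∧-pos  : ∀ {Γ R U A B} → member U R →
             ⊢ Γ ,, (R , A) → ⊢ Γ ,, (R , B) → ⊢ Γ ,, (R , and U A B)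
    ⊃-neg  : ∀ {Γ R f U A B} → ¬ member U R →
             ⊢ Γ ,, (preimage f R , A) ,, (R , B) → ⊢ Γ ,, (R , imp f U A B)
    ⊃-pos  : ∀ {Γ₁ Γ₂ R f U A B} → member U R →
             ⊢ Γ₁ ,, (preimage f R , A) → ⊢ Γ₂ ,, (R , B) →
             ⊢ (Γ₁ ++ Γ₂) ,, (R , imp f U A B)
    ∀-neg  : ∀ {Γ R U A} → ¬ member U R → (t : Term) →
             ⊢ Γ ,, (R , A [0:= t ]) → ⊢ Γ ,, (R , all U A)
    -- eigenvariable condition via de Bruijn: the context is weakened so the
    -- bound variable (index 0) does not occur free in it
    ∀-pos  : ∀ {Γ R U A} → member U R →
             ⊢ map wkI Γ ,, (R , A) → ⊢ Γ ,, (R , all U A)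

-- Every connective labelled by an ultrafilter U is introduced at [ℛ] by its
-- positive rule, since ℛ ∈ U; as moreover f⁻¹(ℛ) = ℛ, the premises are again
-- sequents of the form Γ, [ℛ]B with B a subformula, and induction on the
-- formula ends at atoms, where ℛ alone is a one-block partition of ℛ.
module Submission where

open import Defs
open import Data.Product using (_,_)
open import Data.List using ([]; map)
open import Data.Fin using (Fin; zero)
open import Data.Unit using (tt)
open import Relation.Binary.PropositionalEquality using (refl)

module _ {Role Fun PSym : Set} where
  open MRL Role Fun PSym

  full∈ : (U : Ultrafilter) → member U full
  full∈ U = IsFilter.full∈ (isFilter U)

  whole : Fin 1 → Subset
  whole _ = full

  whole-disjoint : PairwiseDisjoint whole
  whole-disjoint zero zero 0≢0 _ _ _ = 0≢0 refl

  whole-covers : CoversAll whole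
  whole-covers _ = zero , tt

  -- f⁻¹(ℛ) and ℛ are definitionally equal, so the ¬ and ⊃ cases typecheck as is.
  ⊢-full : (Γ : Sequent) (A : Formula) → ⊢ Γ ,, (full , A)
  ⊢-full Γ (atom P ts)   = Id Γ P ts 0 whole whole-disjoint whole-covers
  ⊢-full Γ (neg f A)     = ¬-rule (⊢-full Γ A)
  ⊢-full Γ (and U A B)   = ∧-pos (full∈ U) (⊢-full Γ A) (⊢-full Γ B)
  ⊢-full Γ (imp f U A B) =
    ⊃-pos {Γ₁ = []} {Γ₂ = Γ} (full∈ U) (⊢-full [] A) (⊢-full Γ B)
  ⊢-full Γ (all U A)     = ∀-pos (full∈ U) (⊢-full (map wkI Γ) A)

lemma2 : (Role Fun PSym : Set) → let open MRL Role Fun PSym in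
    (Γ : Sequent) (A : Formula) → ⊢ Γ ,, (full , A)
lemma2 _ _ _ = ⊢-full
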